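{- $\mathcal F_0$ is cofinal in the family of all finite Hasse partial orders: for every finite Hasse partial order $P$ there are $Q\in\mathcal F_0$ and an epimorphism $Q\to P$.
   Context: Let $\mathcal L_R=\{R,\le\}$. A finite Hasse partial order (HPO) is a finite (discrete) $\mathcal L_R$-structure $P$ where $\le^P$ is a partial order and $a\,R^P\,b$ iff $a=b$ or one of $a,b$ is an immediate $\le^P$-successor of the other; it is a Hasse linear order (HLO) if $\le^P$ is total, and a Hasse forest if its Hasse diagram has no cycles. An epimorphism $\varphi:A\to B$ of $\mathcal L_R$-structures is a surjection with $r^B=(\varphi\times\varphi)[r^A]$ for $r\in\{R,\le\}$. $\mathcal F_0$ is the family of finite Hasse forests whose maximal chains are pairwise disjoint, i.e. finite disjoint unions of finite HLOs. -}

module Defs where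

open import Level using (0ℓ)
open import Data.Nat using (ℕ; _≥_)
open import Data.Fin using (Fin)
open import Data.List using (List; []; _∷_; length; last)
open import Data.Maybe using (just; nothing)
open import Data.List.Relation.Unary.Linked using (Linked)
open import Data.List.Relation.Unary.Unique.Propositional using (Unique)
open import Data.Product using (Σ; _×_; ∃; ∃-syntax)
open import Data.Sum using (_⊎_)
open import Data.Empty using (⊥)
open import Data.Unit using (⊤)
open import Relation.Nullary using (¬_)
open import Relation.Binary.PropositionalEquality using (_≡_)
open import Relation.Binary.Structures using (IsPartialOrder)
open import Function.Bundles using (_⇔_)

record FinLR : Set₁ where
  field
    size : ℕ
    R    : Fin size → Fin size → Set
    Le   : Fin size → Fin size → Set
open FinLR public

Carrier : FinLR → Set
Carrier P = Fin (size P)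

Cover : (P : FinLR) → Carrier P → Carrier P → Set
Cover P a b = Le P a b × ¬ (a ≡ b) ×
  (∀ c → Le P a c → Le P c b → (c ≡ a) ⊎ (c ≡ b))

IsHPO : FinLR → Set
IsHPO P = IsPartialOrder _≡_ (Le P) ×
  (∀ a b → R P a b ⇔ ((a ≡ b) ⊎ Cover P a b ⊎ Cover P b a))

HasseEdge : (P : FinLR) → Carrier P → Carrier P → Set
HasseEdge P a b = Cover P a b ⊎ Cover P b a

ClosesUp : (P : FinLR) → List (Carrier P) → Set
ClosesUp P [] = ⊥
ClosesUp P (v ∷ vs) with last (v ∷ vs)
... | just w  = HasseEdge P w v
... | nothing = ⊥

IsHasseCycle : (P : FinLR) → List (Carrier P) → Set
IsHasseCycle P vs = length vs ≥ 3 × Unique vs × Linked (HasseEdge P) vs × ClosesUp P vs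

IsHasseForest : FinLR → Set
IsHasseForest P = IsHPO P × (∀ vs → ¬ IsHasseCycle P vs)

Subset : FinLR → Set₁
Subset P = Carrier P → Set

_⊆_ : {P : FinLR} → Subset P → Subset P → Set
_⊆_ {P} C D = ∀ x → C x → D x

IsChain : (P : FinLR) → Subset P → Set
IsChain P C = ∀ a b → C a → C b → Le P a b ⊎ Le P b a

IsMaximalChain : (P : FinLR) → Subset P → Set₁
IsMaximalChain P C = IsChain P C × (∀ D → IsChain P D → _⊆_ {P} C D → _⊆_ {P} D C)

-- maximal chains pairwise disjoint: two maximal chains sharing a point coincide
MaxChainsDisjoint : FinLR → Set₁
MaxChainsDisjoint P = ∀ C D → IsMaximalChain P C → IsMaximalChain P D →
  (∃[ x ] (C x × D x)) → (_⊆_ {P} C D × _⊆_ {P} D C)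

InF0 : FinLR → Set₁
InF0 P = IsHasseForest P × MaxChainsDisjoint P

Surjective : {A B : Set} → (A → B) → Set
Surjective {A} f = ∀ y → ∃[ x ] (f x ≡ y)

ImageRel : (A B : FinLR) → (Carrier A → Carrier B) →
  (Carrier A → Carrier A → Set) → (Carrier B → Carrier B → Set) → Set
ImageRel A B φ rA rB = ∀ x y → rB x y ⇔ (∃[ a ] ∃[ b ] (φ a ≡ x × φ b ≡ y × rA a b))

IsEpimorphism : (A B : FinLR) → (Carrier A → Carrier B) → Set
IsEpimorphism A B φ = Surjective φ × ImageRel A B φ (R A) (R B) × ImageRel A B φ (Le A) (Le B)

-- For each pair x, y of P take the chain x = c₀ ⋖ c₁ ⋖ ⋯ ⋖ c_k ⋖ y obtained by
-- repeatedly stepping to the least-indexed upper cover below y (just x if x ≰ y).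
-- Q is the disjoint union of these chains, each a Hasse linear order, so Q lies in
-- F₀; sending a chain point to the element of P it names is an epimorphism, since
-- the chain for x ≤ y joins x to y and the chain for a cover x ⋖ y is {x ⋖ y}.
-- Consecutive chain points are covers in P. Where the greedy chain stops below y this
-- is shown by contradiction: a point strictly between would give one more greedy step.
-- Finding that step needs ≤ to be decidable, which may be assumed since the goal is ⊥.

module Submission where

open import Defs
open import Data.Bool using (true; false)
open import Data.Empty using (⊥; ⊥-elim)
open import Data.Fin using (Fin; zero; suc; toℕ; fromℕ; fromℕ<)
open import Data.Fin.Properties using (toℕ-injective; toℕ<n; toℕ-fromℕ; toℕ-fromℕ<; *↔×; any?; all?; sequence) renaming (_≟_ to _≟ᶠ_)
import Data.Fin.Subset as Sub
open import Data.Fin.Subset.Properties using (p⊂q⇒∣p∣<∣q∣; ∣p∣≤n)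
open import Data.List using (List; []; _∷_; last)
open import Data.List.Relation.Unary.All using (All; _∷_)
open import Data.List.Relation.Unary.AllPairs using (_∷_)
open import Data.List.Relation.Unary.Linked as Linked using (Linked; _∷_)
open import Data.List.Relation.Unary.Unique.Propositional using (Unique)
open import Data.Maybe using (just)
open import Data.Nat using (ℕ; zero; suc; _+_; _*_; _<_; _≤_; z≤n; s≤s; s≤s⁻¹)
open import Data.Nat.Induction using (<-wellFounded)
open import Data.Nat.Properties using (<-cmp; <-asym; <-irrefl; <-trans; <⇒≤; ≤-<-trans; <-≤-trans; n<1+n; m≤n⇒m<n∨m≡n)
open import Data.Product using (Σ; _×_; _,_; proj₁; proj₂; ∃-syntax)
open import Data.Product.Function.NonDependent.Propositional using (_×-↔_)
open import Data.Sum using (_⊎_; inj₁; inj₂; swap; [_,_]; map; map₂)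
open import Data.Vec using (tabulate)
open import Data.Vec.Properties using (lookup∘tabulate; lookup⇒[]=; []=⇒lookup)
open import Effect.Monad using (RawMonad)
open import Function using (id; flip)
open import Function.Bundles using (_↔_; Inverse; Equivalence; mk⇔)
open import Function.Construct.Composition using (_↔-∘_)
open import Function.Properties.Inverse using (↔-refl)
open import Induction.WellFounded using (Acc; acc; WellFounded)
import Relation.Binary.Construct.On as On
open import Relation.Binary.Definitions using (tri<; tri≈; tri>)
open import Relation.Binary.PropositionalEquality using (_≡_; _≢_; refl; sym; trans; cong; subst; subst₂; isEquivalence)
open import Relation.Binary.Structures using (IsPartialOrder)
open import Relation.Nullary using (¬_; Dec; yes; no; does)
open import Relation.Nullary.Decidable using (dec-true; dec-false; decidable-stable; ¬¬-excluded-middle; _×-dec_; _⊎-dec_; _→-dec_; ¬?)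
open import Relation.Nullary.Negation using (¬¬-Monad)

least-witness : ∀ {k} {A : Fin k → Set} → (∀ i → Dec (A i)) → ∀ {i} → A i →
                ∃[ j ] (A j × (∀ {j₀} → toℕ j₀ < toℕ j → ¬ A j₀))
least-witness {suc k} A? {i} Ai with A? zero
... | yes A0 = zero , A0 , λ ()
least-witness {suc k} A? {zero}  A0 | no ¬A0 = ⊥-elim (¬A0 A0)
least-witness {suc k} A? {suc i} Ai | no ¬A0 with least-witness (λ j → A? (suc j)) Ai
... | j , Aj , minimal = suc j , Aj , λ { {zero} _ → ¬A0 ; {suc j₀} j₀<j → minimal (s≤s⁻¹ j₀<j) }

≡⊎≡-stable : ∀ {k} {z a b : Fin k} → (z ≢ a → z ≢ b → ⊥) → z ≡ a ⊎ z ≡ b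
≡⊎≡-stable {z = z} {a} {b} ¬neither with z ≟ᶠ a | z ≟ᶠ b
... | yes z≡a | _       = inj₁ z≡a
... | no _    | yes z≡b = inj₂ z≡b
... | no z≢a  | no z≢b  = ⊥-elim (¬neither z≢a z≢b)

lastOf : {X : Set} → X → List X → X
lastOf a []       = a
lastOf _ (b ∷ bs) = lastOf b bs

last≡lastOf : ∀ {X : Set} (v : X) vs → last (v ∷ vs) ≡ just (lastOf v vs)
last≡lastOf v []       = refl
last≡lastOf _ (w ∷ ws) = last≡lastOf w ws

module CoverPaths {X : Set} (_⋖_ : X → X → Set) (_⊏_ : X → X → Set)
  (⊏-trans : ∀ {a b c} → a ⊏ b → b ⊏ c → a ⊏ c)
  (⊏-irrefl : ∀ {a} → ¬ a ⊏ a)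
  (⋖⇒⊏ : ∀ {a b} → a ⋖ b → a ⊏ b)
  (upper-cover-unique : ∀ {a b c} → a ⋖ b → a ⋖ c → b ≡ c)
  (lower-cover-unique : ∀ {a b c} → a ⋖ c → b ⋖ c → a ≡ b) where

  Adjacent : X → X → Set
  Adjacent a b = a ⋖ b ⊎ b ⋖ a

  All-lastOf : ∀ {P : X → Set} a as → All P (a ∷ as) → P (lastOf a as)
  All-lastOf a []       (pa ∷ _)  = pa
  All-lastOf _ (b ∷ bs) (_ ∷ pbs) = All-lastOf b bs pbs

  -- A walk entered by an upward step can only continue upwards: stepping down
  -- would lead back to the unique lower cover, i.e. to the previous vertex.
  ascending : ∀ {p} a as → p ⋖ a → Linked Adjacent (a ∷ as) → All (p ≢_) as →
              Unique (a ∷ as) → p ⊏ lastOf a as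
  ascending a []       p⋖a _                 _           _ = ⋖⇒⊏ p⋖a
  ascending a (b ∷ bs) p⋖a (inj₂ b⋖a ∷ _)    (p≢b ∷ _)   _ = ⊥-elim (p≢b (lower-cover-unique p⋖a b⋖a))
  ascending a (b ∷ bs) p⋖a (inj₁ a⋖b ∷ walk) (_ ∷ p∉bs) ((_ ∷ a∉bs) ∷ distinct) =
    ⊏-trans (⋖⇒⊏ p⋖a) (ascending b bs a⋖b walk a∉bs distinct)

  no-cycle-upwards : ∀ {v₀ v₁ v₂} vs → v₀ ⋖ v₁ → Linked Adjacent (v₁ ∷ v₂ ∷ vs) →
                     Unique (v₀ ∷ v₁ ∷ v₂ ∷ vs) → ¬ Adjacent (lastOf v₂ vs) v₀
  no-cycle-upwards {v₁ = v₁} {v₂} vs v₀⋖v₁ walk ((_ ∷ v₀∉) ∷ (v₁∉ ∷ distinct)) closing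
    with ascending v₁ (v₂ ∷ vs) v₀⋖v₁ walk v₀∉ (v₁∉ ∷ distinct) | closing
  ... | v₀⊏w | inj₁ w⋖v₀ = ⊏-irrefl (⊏-trans v₀⊏w (⋖⇒⊏ w⋖v₀))
  ... | _    | inj₂ v₀⋖w = All-lastOf v₂ vs v₁∉ (upper-cover-unique v₀⋖v₁ v₀⋖w)

-- Q on Fin m: the active points of each component form a chain ordered by level,
-- all other points are isolated.
module LevelledChains {m : ℕ} {I : Set}
  (component : Fin m → I) (level : Fin m → ℕ) (Active : Fin m → Set)
  (level-injective : ∀ {p q} → Active p → Active q →
                     component p ≡ component q → level p ≡ level q → p ≡ q) where

  Below : Fin m → Fin m → Set
  Below p q = component p ≡ component q × level p < level q × Active p × Active q

  _≼_ : Fin m → Fin m → Set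
  p ≼ q = p ≡ q ⊎ Below p q

  _⋖_ : Fin m → Fin m → Set
  p ⋖ q = p ≼ q × p ≢ q × (∀ z → p ≼ z → z ≼ q → z ≡ p ⊎ z ≡ q)

  Q : FinLR
  Q = record { size = m ; R = λ p q → p ≡ q ⊎ p ⋖ q ⊎ q ⋖ p ; Le = _≼_ }

  Below-trans : ∀ {p q r} → Below p q → Below q r → Below p r
  Below-trans (c₁ , l₁ , ap , _) (c₂ , l₂ , _ , ar) = trans c₁ c₂ , <-trans l₁ l₂ , ap , ar

  ≼-trans : ∀ {p q r} → p ≼ q → q ≼ r → p ≼ r
  ≼-trans (inj₁ refl) q≼r         = q≼r
  ≼-trans (inj₂ p<q)  (inj₁ refl) = inj₂ p<q
  ≼-trans (inj₂ p<q)  (inj₂ q<r)  = inj₂ (Below-trans p<q q<r)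

  ≼-antisym : ∀ {p q} → p ≼ q → q ≼ p → p ≡ q
  ≼-antisym (inj₁ p≡q)            _                     = p≡q
  ≼-antisym (inj₂ _)              (inj₁ q≡p)            = sym q≡p
  ≼-antisym (inj₂ (_ , l₁ , _))   (inj₂ (_ , l₂ , _))   = ⊥-elim (<-asym l₁ l₂)

  ≼-isPartialOrder : IsPartialOrder _≡_ _≼_
  ≼-isPartialOrder = record
    { isPreorder = record { isEquivalence = isEquivalence ; reflexive = inj₁ ; trans = ≼-trans }
    ; antisym    = ≼-antisym }

  ⋖⇒Below : ∀ {p q} → p ⋖ q → Below p q
  ⋖⇒Below (inj₁ p≡q , p≢q , _) = ⊥-elim (p≢q p≡q)
  ⋖⇒Below (inj₂ p<q , _)       = p<q

  ⋖-no-between : ∀ {p q z} → p ⋖ q → Below p z → Below z q → ⊥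
  ⋖-no-between (_ , _ , between) p<z@(_ , l₁ , _) z<q@(_ , l₂ , _) with between _ (inj₂ p<z) (inj₂ z<q)
  ... | inj₁ refl = <-irrefl refl l₁
  ... | inj₂ refl = <-irrefl refl l₂

  no-between⇒⋖ : ∀ {p q} → Below p q → (∀ z → Below p z → Below z q → ⊥) → p ⋖ q
  no-between⇒⋖ p<q@(_ , l , _) gap = inj₂ p<q , (λ { refl → <-irrefl refl l }) , between
    where
    between : ∀ z → _ ≼ z → z ≼ _ → z ≡ _ ⊎ z ≡ _
    between z (inj₁ p≡z) _           = inj₁ (sym p≡z)
    between z (inj₂ _)   (inj₁ z≡q)  = inj₂ z≡q
    between z (inj₂ p<z) (inj₂ z<q)  = ⊥-elim (gap z p<z z<q)

  InComponent : I → Fin m → Set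
  InComponent i p = Active p × component p ≡ i

  trichotomous : ∀ {i p q} → InComponent i p → InComponent i q → Below p q ⊎ p ≡ q ⊎ Below q p
  trichotomous {p = p} {q} (ap , cp) (aq , cq) with <-cmp (level p) (level q)
  ... | tri< l _ _ = inj₁ (trans cp (sym cq) , l , ap , aq)
  ... | tri≈ _ e _ = inj₂ (inj₁ (level-injective ap aq (trans cp (sym cq)) e))
  ... | tri> _ _ l = inj₂ (inj₂ (trans cq (sym cp) , l , aq , ap))

  comparable : ∀ {i p q} → InComponent i p → InComponent i q → p ≼ q ⊎ q ≼ p
  comparable ip iq with trichotomous ip iq
  ... | inj₁ p<q        = inj₁ (inj₂ p<q)
  ... | inj₂ (inj₁ p≡q) = inj₁ (inj₁ p≡q)
  ... | inj₂ (inj₂ q<p) = inj₂ (inj₂ q<p)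

  comparable-InComponent : ∀ {i p q} → InComponent i p → p ≼ q ⊎ q ≼ p → InComponent i q
  comparable-InComponent ip              (inj₁ (inj₁ refl))          = ip
  comparable-InComponent ip              (inj₂ (inj₁ refl))          = ip
  comparable-InComponent (_ , cp)        (inj₁ (inj₂ (c , _ , _ , aq))) = aq , trans (sym c) cp
  comparable-InComponent (_ , cp)        (inj₂ (inj₂ (c , _ , aq , _))) = aq , trans c cp

  ⋖-upper-unique : ∀ {p q r} → p ⋖ q → p ⋖ r → q ≡ r
  ⋖-upper-unique p⋖q p⋖r with ⋖⇒Below p⋖q | ⋖⇒Below p⋖r
  ... | cq , _ , _ , aq | cr , _ , _ , ar with trichotomous (aq , sym cq) (ar , sym cr)
  ... | inj₁ q<r        = ⊥-elim (⋖-no-between p⋖r (⋖⇒Below p⋖q) q<r)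
  ... | inj₂ (inj₁ q≡r) = q≡r
  ... | inj₂ (inj₂ r<q) = ⊥-elim (⋖-no-between p⋖q (⋖⇒Below p⋖r) r<q)

  ⋖-lower-unique : ∀ {p q r} → p ⋖ r → q ⋖ r → p ≡ q
  ⋖-lower-unique p⋖r q⋖r with ⋖⇒Below p⋖r | ⋖⇒Below q⋖r
  ... | cp , _ , ap , _ | cq , _ , aq , _ with trichotomous (ap , cp) (aq , cq)
  ... | inj₁ p<q        = ⊥-elim (⋖-no-between p⋖r p<q (⋖⇒Below q⋖r))
  ... | inj₂ (inj₁ p≡q) = p≡q
  ... | inj₂ (inj₂ q<p) = ⊥-elim (⋖-no-between q⋖r q<p (⋖⇒Below p⋖r))

  private
    module Up = CoverPaths _⋖_ (λ p q → level p < level q) <-trans (<-irrefl refl)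
                  (λ p⋖q → proj₁ (proj₂ (⋖⇒Below p⋖q))) ⋖-upper-unique ⋖-lower-unique
    module Down = CoverPaths (flip _⋖_) (λ p q → level q < level p) (λ l₁ l₂ → <-trans l₂ l₁) (<-irrefl refl)
                    (λ q⋖p → proj₁ (proj₂ (⋖⇒Below q⋖p))) ⋖-lower-unique ⋖-upper-unique

  closing-edge : ∀ v vs → ClosesUp Q (v ∷ vs) → Up.Adjacent (lastOf v vs) v
  closing-edge v []       closes = closes
  closing-edge v (w ∷ ws) closes with last (w ∷ ws) | last≡lastOf w ws
  ... | _ | refl = closes

  Hasse-acyclic : ∀ vs → ¬ IsHasseCycle Q vs
  Hasse-acyclic []                 (() , _)
  Hasse-acyclic (_ ∷ [])           (s≤s () , _)
  Hasse-acyclic (_ ∷ _ ∷ [])       (s≤s (s≤s ()) , _)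
  Hasse-acyclic (v₀ ∷ v₁ ∷ v₂ ∷ vs) (_ , distinct , inj₁ v₀⋖v₁ ∷ walk , closes) =
    Up.no-cycle-upwards vs v₀⋖v₁ walk distinct (closing-edge v₀ (v₁ ∷ v₂ ∷ vs) closes)
  Hasse-acyclic (v₀ ∷ v₁ ∷ v₂ ∷ vs) (_ , distinct , inj₂ v₁⋖v₀ ∷ walk , closes) =
    Down.no-cycle-upwards vs v₁⋖v₀ (Linked.map swap walk) distinct (swap (closing-edge v₀ (v₁ ∷ v₂ ∷ vs) closes))

  maximal-chain-absorbs : ∀ {i x z} (D : Subset Q) → IsMaximalChain Q D → D x →
                          InComponent i x → InComponent i z → D z
  maximal-chain-absorbs {i} {x} {z} D (D-chain , D-maximal) x∈D ix iz =
    D-maximal D⁺ D⁺-chain (λ _ → inj₁) z (inj₂ refl)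
    where
    D⁺ : Subset Q
    D⁺ w = D w ⊎ w ≡ z
    in-component : ∀ {w} → D w → InComponent i w
    in-component w∈D = comparable-InComponent ix (D-chain _ _ x∈D w∈D)
    D⁺-chain : IsChain Q D⁺
    D⁺-chain a b (inj₁ a∈D) (inj₁ b∈D) = D-chain a b a∈D b∈D
    D⁺-chain a b (inj₁ a∈D) (inj₂ refl) = comparable (in-component a∈D) iz
    D⁺-chain a b (inj₂ refl) (inj₁ b∈D) = comparable iz (in-component b∈D)
    D⁺-chain a b (inj₂ refl) (inj₂ refl) = inj₁ (inj₁ refl)

  chain-meeting-maximal-chain⊆ : ∀ (C D : Subset Q) → IsChain Q C → IsMaximalChain Q D →
                                 ∀ x → C x → D x → _⊆_ {Q} C D
  chain-meeting-maximal-chain⊆ C D C-chain D-max x x∈C x∈D z z∈C with C-chain x z x∈C z∈C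
  ... | inj₁ (inj₁ refl)              = x∈D
  ... | inj₂ (inj₁ refl)              = x∈D
  ... | inj₁ (inj₂ (c , _ , ax , az)) = maximal-chain-absorbs D D-max x∈D (ax , refl) (az , sym c)
  ... | inj₂ (inj₂ (c , _ , az , ax)) = maximal-chain-absorbs D D-max x∈D (ax , refl) (az , c)

  Q-inF0 : InF0 Q
  Q-inF0 = ((≼-isPartialOrder , λ _ _ → mk⇔ id id) , Hasse-acyclic) ,
           λ C D C-max D-max (x , x∈C , x∈D) →
             chain-meeting-maximal-chain⊆ C D (proj₁ C-max) D-max x x∈C x∈D ,
             chain-meeting-maximal-chain⊆ D C (proj₁ D-max) C-max x x∈D x∈C

module ChainUnfolding (P : FinLR) (hpo : IsHPO P) where

  n : ℕ
  n = size P

  _≤ₚ_ : Fin n → Fin n → Set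
  _≤ₚ_ = Le P

  _⋖ₚ_ : Fin n → Fin n → Set
  _⋖ₚ_ = Cover P

  module ≤ₚ = IsPartialOrder (proj₁ hpo)

  -- The least-index condition makes each level carry at most one vertex.
  data Greedy (x y : Fin n) : ℕ → Fin n → Set where
    start : Greedy x y 0 x
    step  : ∀ {k c d} → Greedy x y k c → c ≢ y → c ⋖ₚ d → d ≤ₚ y →
            (∀ {d₀} → toℕ d₀ < toℕ d → c ⋖ₚ d₀ → d₀ ≤ₚ y → ⊥) → Greedy x y (suc k) d

  module _ {x y : Fin n} where

    greedy-functional : ∀ {k a b} → Greedy x y k a → Greedy x y k b → a ≡ b
    greedy-functional start start = refl
    greedy-functional (step {d = a} ga _ ⋖a a≤y a-least) (step {d = b} gb _ ⋖b b≤y b-least)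
      with greedy-functional ga gb
    ... | refl with <-cmp (toℕ a) (toℕ b)
    ... | tri< a<b _ _ = ⊥-elim (b-least a<b ⋖a a≤y)
    ... | tri≈ _ a≡b _ = toℕ-injective a≡b
    ... | tri> _ _ b<a = ⊥-elim (a-least b<a ⋖b b≤y)

    greedy-from : ∀ {k e} → Greedy x y k e → x ≤ₚ e
    greedy-from start                = ≤ₚ.refl
    greedy-from (step g _ c⋖e _ _)   = ≤ₚ.trans (greedy-from g) (proj₁ c⋖e)

    greedy-to : ∀ {k e} → Greedy x y k e → 0 < k → e ≤ₚ y
    greedy-to (step _ _ _ e≤y _) _ = e≤y

    greedy-leaves-start : ∀ {k e} → Greedy x y k e → 0 < k → e ≢ x
    greedy-leaves-start (step g _ c⋖e _ _) _ refl =
      proj₁ (proj₂ c⋖e) (≤ₚ.antisym (proj₁ c⋖e) (greedy-from g))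

    greedy-monotone : ∀ {i j a b} → Greedy x y i a → Greedy x y j b → i ≤ j → a ≤ₚ b
    greedy-monotone ga start z≤n = ≤ₚ.reflexive (greedy-functional ga start)
    greedy-monotone ga gb@(step gc _ c⋖b _ _) i≤j with m≤n⇒m<n∨m≡n i≤j
    ... | inj₁ (s≤s i≤k) = ≤ₚ.trans (greedy-monotone ga gc i≤k) (proj₁ c⋖b)
    ... | inj₂ refl      = ≤ₚ.reflexive (greedy-functional ga gb)

  data Vertex (x y : Fin n) : ℕ → Fin n → Set where
    bottom : Vertex x y 0 x
    inner  : ∀ {k e} → Greedy x y k e → e ≢ y → 0 < k → k ≤ n → Vertex x y k e
    top    : x ≤ₚ y → Vertex x y (suc n) y

  module _ {x y : Fin n} where

    vertex-greedy : ∀ {k e} → Vertex x y k e → k ≤ n → Greedy x y k e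
    vertex-greedy bottom            _   = start
    vertex-greedy (inner g _ _ _)   _   = g
    vertex-greedy (top _)           k≤n = ⊥-elim (<-irrefl refl k≤n)

    vertex-unique : ∀ {k a b} → Vertex x y k a → Vertex x y k b → a ≡ b
    vertex-unique bottom            bottom            = refl
    vertex-unique bottom            (inner _ _ () _)
    vertex-unique (inner _ _ () _)  bottom
    vertex-unique (inner ga _ _ _)  (inner gb _ _ _)  = greedy-functional ga gb
    vertex-unique (inner _ _ _ k≤n) (top _)           = ⊥-elim (<-irrefl refl k≤n)
    vertex-unique (top _)           (inner _ _ _ k≤n) = ⊥-elim (<-irrefl refl k≤n)
    vertex-unique (top _)           (top _)           = refl

    vertex-monotone : ∀ {i j a b} → Vertex x y i a → Vertex x y j b → i < j → a ≤ₚ b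
    vertex-monotone va                (bottom)          ()
    vertex-monotone bottom            (top x≤y)         _   = x≤y
    vertex-monotone (inner g _ 0<i _) (top _)           _   = greedy-to g 0<i
    vertex-monotone (top _)           (top _)           i<j = ⊥-elim (<-irrefl refl i<j)
    vertex-monotone va                (inner gb _ _ j≤n) i<j =
      greedy-monotone (vertex-greedy va (<⇒≤ (<-≤-trans i<j j≤n))) gb (<⇒≤ i<j)

  NoVertexBetween : Fin n → Fin n → ℕ → ℕ → Set
  NoVertexBetween x y i j = ∀ {k d} → i < k → k < j → ¬ Vertex x y k d

  ≤ₚ-decidable-¬¬ : ¬ ¬ (∀ a b → Dec (a ≤ₚ b))
  ≤ₚ-decidable-¬¬ = sequence ¬¬-applicative λ _ → sequence ¬¬-applicative λ _ → ¬¬-excluded-middle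
    where ¬¬-applicative = RawMonad.rawApplicative ¬¬-Monad

  module WithDecidableOrder (_≤?_ : ∀ a b → Dec (a ≤ₚ b)) where

    downset : Fin n → Sub.Subset n
    downset b = tabulate (λ a → does (a ≤? b))

    ∈-downset⁺ : ∀ {a b} → a ≤ₚ b → a Sub.∈ downset b
    ∈-downset⁺ {a} {b} a≤b = lookup⇒[]= a _ (trans (lookup∘tabulate _ a) (dec-true (a ≤? b) a≤b))

    ∈-downset⁻ : ∀ {a b} → a Sub.∈ downset b → a ≤ₚ b
    ∈-downset⁻ {a} {b} a∈ = decidable-stable (a ≤? b) λ a≰b →
      true≢false (trans (sym ([]=⇒lookup a∈)) (trans (lookup∘tabulate _ a) (dec-false (a ≤? b) a≰b)))
      where
      true≢false : true ≢ false
      true≢false ()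

    height : Fin n → ℕ
    height b = Sub.∣ downset b ∣

    height-strict : ∀ {a b} → a ≤ₚ b → a ≢ b → height a < height b
    height-strict {a} {b} a≤b a≢b = p⊂q⇒∣p∣<∣q∣
      ( (λ w∈a → ∈-downset⁺ (≤ₚ.trans (∈-downset⁻ w∈a) a≤b))
      , b , ∈-downset⁺ ≤ₚ.refl , λ b∈a → a≢b (≤ₚ.antisym a≤b (∈-downset⁻ b∈a)) )

    height-wellFounded : WellFounded (λ a b → height a < height b)
    height-wellFounded = On.wellFounded height <-wellFounded

    module _ {x y : Fin n} where

      greedy-height : ∀ {k e} → Greedy x y k e → k ≤ height e
      greedy-height start              = z≤n
      greedy-height (step g _ c⋖e _ _) = ≤-<-trans (greedy-height g) (height-strict (proj₁ c⋖e) (proj₁ (proj₂ c⋖e)))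

      greedy-level-bound : ∀ {k e} → Greedy x y k e → e ≤ₚ y → e ≢ y → k < n
      greedy-level-bound g e≤y e≢y =
        ≤-<-trans (greedy-height g) (<-≤-trans (height-strict e≤y e≢y) (∣p∣≤n (downset y)))

    _⋖ₚ?_ : ∀ a b → Dec (a ⋖ₚ b)
    a ⋖ₚ? b = a ≤? b ×-dec ¬? (a ≟ᶠ b) ×-dec
              all? (λ c → a ≤? c →-dec (c ≤? b →-dec ((c ≟ᶠ a) ⊎-dec (c ≟ᶠ b))))

    cover-below : ∀ {e c} → Acc (λ a b → height a < height b) c → e ≤ₚ c → e ≢ c →
                  ∃[ d ] (e ⋖ₚ d × d ≤ₚ c)
    cover-below {e} {c} (acc smaller) e≤c e≢c
      with any? (λ d → e ≤? d ×-dec ¬? (e ≟ᶠ d) ×-dec d ≤? c ×-dec ¬? (d ≟ᶠ c))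
    ... | yes (d , e≤d , e≢d , d≤c , d≢c) =
      let (d₀ , e⋖d₀ , d₀≤d) = cover-below (smaller (height-strict d≤c d≢c)) e≤d e≢d
      in d₀ , e⋖d₀ , ≤ₚ.trans d₀≤d d≤c
    ... | no nothing-between = c , (e≤c , e≢c , between) , ≤ₚ.refl
      where
      between : ∀ z → e ≤ₚ z → z ≤ₚ c → z ≡ e ⊎ z ≡ c
      between z e≤z z≤c = ≡⊎≡-stable λ z≢e z≢c →
        nothing-between (z , e≤z , (λ e≡z → z≢e (sym e≡z)) , z≤c , z≢c)

    module _ {x y : Fin n} where

      greedy-extends : ∀ {k e c} → Greedy x y k e → e ≤ₚ c → c ≤ₚ y → c ≢ e →
                       ∃[ d ] (e ⋖ₚ d × Greedy x y (suc k) d)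
      greedy-extends {e = e} {c} g e≤c c≤y c≢e
        with cover-below (height-wellFounded c) e≤c (λ e≡c → c≢e (sym e≡c))
      ... | d₀ , e⋖d₀ , d₀≤c with least-witness (λ d → e ⋖ₚ? d ×-dec d ≤? y) (e⋖d₀ , ≤ₚ.trans d₀≤c c≤y)
      ... | d , (e⋖d , d≤y) , minimal = d , e⋖d , step g e≢y e⋖d d≤y (λ d₁<d e⋖d₁ d₁≤y → minimal d₁<d (e⋖d₁ , d₁≤y))
        where
        e≢y : e ≢ y
        e≢y refl = c≢e (≤ₚ.antisym c≤y e≤c)

      no-point-below-top : ∀ {i a c} → Greedy x y i a → NoVertexBetween x y i (suc n) →
                           a ≤ₚ c → c ≤ₚ y → c ≢ a → c ≢ y → ⊥
      no-point-below-top {i} g gap a≤c c≤y c≢a c≢y with greedy-extends g a≤c c≤y c≢a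
      ... | d , a⋖d , gd with d ≟ᶠ y
      ... | yes refl = [ c≢a , c≢y ] (proj₂ (proj₂ a⋖d) _ a≤c c≤y)
      ... | no d≢y   = gap (n<1+n _) (s≤s (<⇒≤ suc-i<n)) (inner gd d≢y (s≤s z≤n) (<⇒≤ suc-i<n))
        where
        suc-i<n : suc i < n
        suc-i<n = greedy-level-bound gd (greedy-to gd (s≤s z≤n)) d≢y

  module _ {x y : Fin n} where

    no-point-between-vertices : ∀ {i j a b c} → Vertex x y i a → Vertex x y j b → i < j →
                                NoVertexBetween x y i j → a ≤ₚ c → c ≤ₚ b → c ≢ a → c ≢ b → ⊥
    no-point-between-vertices va bottom ()
    no-point-between-vertices va (inner (step gc c₀≢y c₀⋖b _ _) _ _ j≤n) (s≤s i≤k) gap a≤c c≤b c≢a c≢b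
      with m≤n⇒m<n∨m≡n i≤k
    ... | inj₁ i<k  = gap i<k (n<1+n _) (inner gc c₀≢y (≤-<-trans z≤n i<k) (<⇒≤ j≤n))
    ... | inj₂ refl with greedy-functional (vertex-greedy va (<⇒≤ j≤n)) gc
    ... | refl = [ c≢a , c≢b ] (proj₂ (proj₂ c₀⋖b) _ a≤c c≤b)
    no-point-between-vertices va (top _) i<j gap a≤c c≤y c≢a c≢y = ≤ₚ-decidable-¬¬ λ _≤?_ →
      WithDecidableOrder.no-point-below-top _≤?_ (vertex-greedy va (s≤s⁻¹ i<j)) gap a≤c c≤y c≢a c≢y

    consecutive-vertices-cover : ∀ {i j a b} → Vertex x y i a → Vertex x y j b → i < j →
                                 NoVertexBetween x y i j → ∀ c → a ≤ₚ c → c ≤ₚ b → c ≡ a ⊎ c ≡ b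
    consecutive-vertices-cover va vb i<j gap c a≤c c≤b =
      ≡⊎≡-stable (no-point-between-vertices va vb i<j gap a≤c c≤b)

  -- A position (x , y , e , r) may carry the point e at level r of the chain for
  -- (x , y); the positions not Placed become isolated points of Q.
  Position : Set
  Position = Fin n × Fin n × Fin n × Fin (2 + n)

  pair : Position → Fin n × Fin n
  pair (x , y , _ , _) = x , y

  rank : Position → ℕ
  rank (_ , _ , _ , r) = toℕ r

  point : Position → Fin n
  point (_ , _ , e , _) = e

  Placed : Position → Set
  Placed (x , y , e , r) = Vertex x y (toℕ r) e

  Precedes : Position → Position → Set
  Precedes s t = pair s ≡ pair t × rank s < rank t × Placed s × Placed t

  placed-unique : ∀ s t → Placed s → Placed t → pair s ≡ pair t → rank s ≡ rank t → s ≡ t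
  placed-unique (x , y , e , r) (.x , .y , _ , _) vs vt refl same-rank with toℕ-injective same-rank
  ... | refl = cong (λ e → x , y , e , r) (vertex-unique vs vt)

  precedes-monotone : ∀ s t → Precedes s t → point s ≤ₚ point t
  precedes-monotone (x , y , _ , _) (.x , .y , _ , _) (refl , lower , vs , vt) = vertex-monotone vs vt lower

  consecutive-positions-cover : ∀ s t → Precedes s t → (∀ u → Precedes s u → Precedes u t → ⊥) →
                                ∀ c → point s ≤ₚ c → c ≤ₚ point t → c ≡ point s ⊎ c ≡ point t
  consecutive-positions-cover (x , y , _ , r) (.x , .y , _ , r₁) (refl , r<r₁ , vs , vt) gap =
    consecutive-vertices-cover vs vt r<r₁ no-vertex
    where
    no-vertex : NoVertexBetween x y (toℕ r) (toℕ r₁)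
    no-vertex {d = d} r<k k<r₁ v with fromℕ< (<-trans k<r₁ (toℕ<n r₁)) | toℕ-fromℕ< (<-trans k<r₁ (toℕ<n r₁))
    ... | rₖ | refl = gap (x , y , d , rₖ) (refl , r<k , vs , v) (refl , k<r₁ , v , vt)

  cover-no-vertex-between : ∀ {x y k d} → x ⋖ₚ y → Vertex x y k d → 0 < k → k < suc n → ⊥
  cover-no-vertex-between x⋖y bottom () _
  cover-no-vertex-between x⋖y (inner g d≢y 0<k _) _ _ =
    [ greedy-leaves-start g 0<k , d≢y ] (proj₂ (proj₂ x⋖y) _ (greedy-from g) (greedy-to g 0<k))
  cover-no-vertex-between x⋖y (top _) _ n<n = <-irrefl refl n<n

  start-of end-of : Fin n → Fin n → Position
  start-of x y = x , y , x , zero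
  end-of   x y = x , y , y , fromℕ (suc n)

  start-precedes-end : ∀ {x y} → x ≤ₚ y → Precedes (start-of x y) (end-of x y)
  start-precedes-end x≤y rewrite toℕ-fromℕ n = refl , s≤s z≤n , bottom , top x≤y

  no-position-inside-cover-chain : ∀ {x y} → x ⋖ₚ y → ∀ u → Precedes (start-of x y) u → Precedes u (end-of x y) → ⊥
  no-position-inside-cover-chain x⋖y (_ , _ , _ , r) (refl , 0<r , _ , v) (refl , r<end , _ , _) rewrite toℕ-fromℕ n =
    cover-no-vertex-between x⋖y v 0<r r<end

  m : ℕ
  m = n * (n * (n * (2 + n)))

  codec : Fin m ↔ Position
  codec = (↔-refl ×-↔ ↔-refl ×-↔ *↔×) ↔-∘ ((↔-refl ×-↔ *↔×) ↔-∘ *↔×)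

  open Inverse codec using ()
    renaming (to to decode; from to encode; strictlyInverseˡ to decode-encode; strictlyInverseʳ to encode-decode)

  decode-injective : ∀ {p q} → decode p ≡ decode q → p ≡ q
  decode-injective {p} {q} eq = trans (sym (encode-decode p)) (trans (cong encode eq) (encode-decode q))

  open LevelledChains (λ p → pair (decode p)) (λ p → rank (decode p)) (λ p → Placed (decode p))
    (λ {p} {q} vp vq same-pair same-rank → decode-injective (placed-unique (decode p) (decode q) vp vq same-pair same-rank))
    public

  φ : Fin m → Fin n
  φ p = point (decode p)

  φ-encode : ∀ t → φ (encode t) ≡ point t
  φ-encode t = cong point (decode-encode t)

  Below-encode : ∀ {s t} → Precedes s t → Below (encode s) (encode t)
  Below-encode {s} {t} = subst₂ Precedes (sym (decode-encode s)) (sym (decode-encode t))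

  φ-monotone : ∀ {p q} → p ≼ q → φ p ≤ₚ φ q
  φ-monotone (inj₁ refl) = ≤ₚ.refl
  φ-monotone {p} {q} (inj₂ p<q) = precedes-monotone (decode p) (decode q) p<q

  ⋖-image : ∀ {p q} → p ⋖ q → φ p ≡ φ q ⊎ φ p ⋖ₚ φ q
  ⋖-image {p} {q} p⋖q with φ p ≟ᶠ φ q
  ... | yes φp≡φq = inj₁ φp≡φq
  ... | no φp≢φq  = inj₂ (φ-monotone (proj₁ p⋖q) , φp≢φq ,
                          consecutive-positions-cover (decode p) (decode q) (⋖⇒Below p⋖q) gap)
    where
    gap : ∀ u → Precedes (decode p) u → Precedes u (decode q) → ⊥
    gap u p<u u<q = ⋖-no-between p⋖q (subst (Precedes (decode p)) (sym (decode-encode u)) p<u)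
                                     (subst (λ s → Precedes s (decode q)) (sym (decode-encode u)) u<q)

  ⋖-lift : ∀ {x y} → x ⋖ₚ y → encode (start-of x y) ⋖ encode (end-of x y)
  ⋖-lift {x} {y} x⋖y = no-between⇒⋖ (Below-encode (start-precedes-end (proj₁ x⋖y))) gap
    where
    gap : ∀ z → Below (encode (start-of x y)) z → Below z (encode (end-of x y)) → ⊥
    gap z start<z z<end = no-position-inside-cover-chain x⋖y (decode z)
      (subst (λ s → Precedes s (decode z)) (decode-encode _) start<z)
      (subst (Precedes (decode z)) (decode-encode _) z<end)

  R-preserved : ∀ {p q} → R Q p q → R P (φ p) (φ q)
  R-preserved {p} {q} r = Equivalence.from (proj₂ hpo (φ p) (φ q)) (image r)
    where
    image : R Q p q → φ p ≡ φ q ⊎ φ p ⋖ₚ φ q ⊎ φ q ⋖ₚ φ p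
    image (inj₁ refl) = inj₁ refl
    image (inj₂ (inj₁ p⋖q)) = map₂ inj₁ (⋖-image p⋖q)
    image (inj₂ (inj₂ q⋖p)) = map sym inj₂ (⋖-image q⋖p)

  φ-epimorphism : IsEpimorphism Q P φ
  φ-epimorphism = surjective , R-image , ≤-image
    where
    surjective : Surjective φ
    surjective y = encode (start-of y y) , φ-encode _

    R-image : ImageRel Q P φ (R Q) (R P)
    R-image u v = mk⇔ lift (λ { (p , q , refl , refl , r) → R-preserved r })
      where
      lift : R P u v → ∃[ p ] ∃[ q ] (φ p ≡ u × φ q ≡ v × R Q p q)
      lift r with Equivalence.to (proj₂ hpo u v) r
      ... | inj₁ refl       = encode (start-of u u) , encode (start-of u u) , φ-encode _ , φ-encode _ , inj₁ refl
      ... | inj₂ (inj₁ u⋖v) = encode (start-of u v) , encode (end-of u v) , φ-encode _ , φ-encode _ , inj₂ (inj₁ (⋖-lift u⋖v))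
      ... | inj₂ (inj₂ v⋖u) = encode (end-of v u) , encode (start-of v u) , φ-encode _ , φ-encode _ , inj₂ (inj₂ (⋖-lift v⋖u))

    ≤-image : ImageRel Q P φ (Le Q) (Le P)
    ≤-image u v = mk⇔ (λ u≤v → encode (start-of u v) , encode (end-of u v) , φ-encode _ , φ-encode _ ,
                                inj₂ (Below-encode (start-precedes-end u≤v)))
                      (λ { (p , q , refl , refl , p≼q) → φ-monotone p≼q })

proposition3p4 : (P : FinLR) → IsHPO P →
    Σ FinLR (λ Q → InF0 Q × Σ (Carrier Q → Carrier P) (λ φ → IsEpimorphism Q P φ))
proposition3p4 P hpo = Q , Q-inF0 , φ , φ-epimorphism
  where open ChainUnfolding P hpo
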